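{- Let $n,k$ be integers with $k\ge 1$ and $n>2k$, and let $P(n,k)$ be the generalized Petersen graph. Let $c$ be a vertex cover of $P(n,k)$ that does not contain all of $V=\{v_1,\dots,v_n\}$, and let $\mathrm{so}(c)$ be its semi-optimal cover (defined in the context). Then (a) $\mathrm{so}(c)$ is a vertex cover of $P(n,k)$, and (b) $|\mathrm{so}(c)|\le |c|$.
   Context: The generalized Petersen graph $P(n,k)$ ($n>2k\ge 2$) has vertex set $U\cup V$ with $U=\{u_1,\dots,u_n\}$, $V=\{v_1,\dots,v_n\}$ and edge set $\{u_iu_{i+1},\,u_iv_i,\,v_iv_{i+k}: i=1,\dots,n\}$, subscripts reduced modulo $n$ into $\{1,\dots,n\}$. The vertices $u_i$ and $v_i$ are called twins. Two vertices of $V$ are consecutive if their subscripts are circularly consecutive (i.e. $v_i,v_{i+1}$ modulo $n$). For a vertex cover $c$ not containing all of $V$, a strip of $c$ is a maximal set of circularly consecutive vertices $\{v_i,v_{i+1},\dots,v_{i+m}\}$ of $V$ all belonging to $c$ (so $v_{i-1},v_{i+m+1}\notin c$); its size is its number of vertices. The semi-optimal cover $\mathrm{so}(c)$ is the vertex set consisting of: all vertices of $V$ in $c$; the twin $u_i$ of every $v_i\in V$ not in $c$; and, for every strip $\{v_i,v_{i+1},\dots,v_{i+m}\}$ of $c$, the vertices $u_{i+1},u_{i+3},u_{i+5},\dots$ among $u_i,\dots,u_{i+m}$ (alternately, beginning with $u_{i+1}$). -}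

module Defs where

open import Data.Nat using (ℕ; zero; suc; _+_; _∸_; _%_; _≡ᵇ_)
open import Data.Nat.DivMod using (_mod_)
open import Data.Bool using (Bool; true; false; if_then_else_; not; _∨_)
open import Data.Fin using (Fin; toℕ)
open import Data.Fin.Subset using (Subset; _∈_; ∣_∣)
open import Data.Vec using (lookup; tabulate)
open import Data.Product using (_×_; _,_; proj₁; proj₂)
open import Data.Sum using (_⊎_)

-- Indices are 0-based: vertex u_i / v_i of the paper corresponds to index i-1 : Fin n.
-- Circular shift: i ↦ (i + j) mod n.
shift : {n : ℕ} → Fin n → ℕ → Fin n
shift {suc m} i j = (toℕ i + j) mod (suc m)

prev : {n : ℕ} → Fin n → Fin n
prev {suc m} i = shift i m

-- A vertex subset of P(n,k) (vertex set U ⊔ V) is given by its U-part and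
-- its V-part, each a subset of the index set Fin n.
VSet : ℕ → Set
VSet n = Subset n × Subset n

size : {n : ℕ} → VSet n → ℕ
size (cu , cv) = ∣ cu ∣ + ∣ cv ∣

IsVertexCover : (n k : ℕ) → VSet n → Set
IsVertexCover n k (cu , cv) =
  (i : Fin n) →
    ((i ∈ cu) ⊎ (shift i 1 ∈ cu)) ×
    ((i ∈ cu) ⊎ (i ∈ cv)) ×
    ((i ∈ cv) ⊎ (shift i k ∈ cv))

-- If v_j ∈ cv and cv ≠ V,
-- then run cv j n is the offset of v_j from the first vertex of its strip.
run : {n : ℕ} → Subset n → Fin n → ℕ → ℕ
run cv j zero = 0
run cv j (suc f) = if lookup cv (prev j) then suc (run cv (prev j) f) else 0

-- Semi-optimal cover so(c): all of c ∩ V; u_j for every v_j ∉ c; and inside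
-- each strip v_i,…,v_{i+m} the vertices u_{i+1}, u_{i+3}, … (odd offsets).
so : {n : ℕ} → VSet n → VSet n
so {n} (cu , cv) =
  tabulate (λ j → not (lookup cv j) ∨ (run cv j n % 2 ≡ᵇ 1)) , cv

module Submission where

-- Let c = (cu , cv) be a vertex cover of P(n,k) with some v_x ∉ cv.
-- (a) The V-part of so(c) is cv, so every edge v_i v_{i+k} stays covered, and
-- every spoke u_i v_i is covered since u_i is added whenever v_i ∉ cv.  Inside
-- a strip the offsets of consecutive vertices from the strip start differ by
-- one, so their parities alternate and one of u_i , u_{i+1} is taken whenever
-- v_i , v_{i+1} ∈ cv; this covers the rim.
-- (b) A charging argument: if u_j ∈ so(c) ∖ cu then v_j ∈ cv (spoke u_j v_j)
-- and v_j has odd offset, so v_{j-1} ∈ cv has even offset and u_{j-1} ∉ so(c),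
-- while u_{j-1} ∈ cu (rim edge u_{j-1} u_j).  As j ↦ j-1 is a permutation,
-- |so(c) ∩ U| ≤ |cu|.

open import Defs
open import Data.Nat using (ℕ; zero; suc; _+_; _*_; _%_; _≡ᵇ_; _≤_; _<_; z≤n; s≤s)
open import Data.Nat.Properties
open import Data.Nat.DivMod using (%-distribˡ-+; m%n%n≡m%n; [m+n]%n≡m%n; [m+kn]%n≡m%n; m<n⇒m%n≡m; m%n<n; m≡m%n+[m/n]*n; _/_)
open import Data.Nat.Tactic.RingSolver using (solve-∀)
open import Data.Bool using (Bool; true; false; not; _∨_; _∧_)
open import Data.Fin using (Fin; toℕ) renaming (zero to fzero; suc to fsuc)
open import Data.Fin.Properties using (toℕ-fromℕ<; toℕ-injective; toℕ<n)
open import Data.Fin.Permutation using (Permutation; permutation; _⟨$⟩ʳ_)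
open import Data.Fin.Subset using (Subset; ∣_∣; _∈_; _∉_)
open import Data.Vec using ([]; _∷_; lookup)
open import Data.Vec.Properties using (lookup∘tabulate; []=⇒lookup; lookup⇒[]=)
open import Data.Product using (_×_; _,_; ∃; proj₁; proj₂)
open import Data.Sum using (_⊎_; inj₁; inj₂; swap)
open import Data.Empty using (⊥-elim)
open import Function using (_∘′_)
open import Relation.Nullary using (¬_)
open import Relation.Binary.PropositionalEquality
open import Algebra.Properties.CommutativeMonoid.Sum +-0-commutativeMonoid
  using (sum; ∑-distrib-+; ∑-permute)

variable
  m n : ℕ

ind : Bool → ℕ
ind true  = 1
ind false = 0

false≢true : ¬ false ≡ true
false≢true ()

∣p∣≡∑ind : (p : Subset n) → ∣ p ∣ ≡ sum (λ i → ind (lookup p i))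
∣p∣≡∑ind []          = refl
∣p∣≡∑ind (true ∷ p)  = cong suc (∣p∣≡∑ind p)
∣p∣≡∑ind (false ∷ p) = ∣p∣≡∑ind p

sum-mono-≤ : (f g : Fin n → ℕ) → (∀ i → f i ≤ g i) → sum f ≤ sum g
sum-mono-≤ {zero}  f g f≤g = z≤n
sum-mono-≤ {suc n} f g f≤g =
  +-mono-≤ (f≤g fzero) (sum-mono-≤ (λ i → f (fsuc i)) (λ i → g (fsuc i)) (λ i → f≤g (fsuc i)))

-- The Boolean core of the charging argument: an element of A ∖ B is paid for
-- by the element of B ∖ A it is sent to.
charge-pointwise : ∀ (a b a′ b′ : Bool) → (a ≡ true → b ≡ false → b′ ≡ true × a′ ≡ false) →
                   ind a + ind (b ∧ not a) ≤ ind b + ind (b′ ∧ not a′)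
charge-pointwise true  true  _ _ _ = s≤s z≤n
charge-pointwise false true  _ _ _ = s≤s z≤n
charge-pointwise false false _ _ _ = z≤n
charge-pointwise true  false a′ b′ charge with charge refl refl
... | refl , refl = s≤s z≤n

card-≤-by-charging : (π : Permutation n n) (A B : Subset n) →
  (∀ i → lookup A i ≡ true → lookup B i ≡ false →
     lookup B (π ⟨$⟩ʳ i) ≡ true × lookup A (π ⟨$⟩ʳ i) ≡ false) →
  ∣ A ∣ ≤ ∣ B ∣
card-≤-by-charging π A B charge =
  subst₂ _≤_ (sym (∣p∣≡∑ind A)) (sym (∣p∣≡∑ind B)) (+-cancelʳ-≤ (sum e) (sum a) (sum b) summed)
  where
  open ≤-Reasoning
  a b e : Fin _ → ℕ
  a i = ind (lookup A i)
  b i = ind (lookup B i)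
  e i = ind (lookup B i ∧ not (lookup A i))

  summed : sum a + sum e ≤ sum b + sum e
  summed = begin
    sum a + sum e                     ≡⟨ ∑-distrib-+ a e ⟨
    sum (λ i → a i + e i)             ≤⟨ sum-mono-≤ _ _ (λ i → charge-pointwise _ _ _ _ (charge i)) ⟩
    sum (λ i → b i + e (π ⟨$⟩ʳ i))    ≡⟨ ∑-distrib-+ b (λ i → e (π ⟨$⟩ʳ i)) ⟩
    sum b + sum (λ i → e (π ⟨$⟩ʳ i))  ≡⟨ cong (sum b +_) (∑-permute e π) ⟨
    sum b + sum e                     ∎

toℕ-shift : (i : Fin (suc m)) (a : ℕ) → toℕ (shift i a) ≡ (toℕ i + a) % suc m
toℕ-shift i a = toℕ-fromℕ< _

shift-≡ : (i j : Fin (suc m)) (a q : ℕ) → toℕ i + a ≡ toℕ j + q * suc m → shift i a ≡ j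
shift-≡ {m} i j a q eq = toℕ-injective (begin
  toℕ (shift i a)              ≡⟨ toℕ-shift i a ⟩
  (toℕ i + a) % suc m          ≡⟨ cong (_% suc m) eq ⟩
  (toℕ j + q * suc m) % suc m  ≡⟨ [m+kn]%n≡m%n (toℕ j) q (suc m) ⟩
  toℕ j % suc m                ≡⟨ m<n⇒m%n≡m (toℕ<n j) ⟩
  toℕ j                        ∎)
  where open ≡-Reasoning

shift-period : (i : Fin (suc m)) (q : ℕ) → shift i (q * suc m) ≡ i
shift-period i q = shift-≡ i i _ q refl

shift-by-size : (i : Fin (suc m)) → shift i (suc m) ≡ i
shift-by-size {m} i = shift-≡ i i _ 1 (cong (toℕ i +_) (sym (*-identityˡ (suc m))))

shift-+ : (i : Fin (suc m)) (a b : ℕ) → shift (shift i a) b ≡ shift i (a + b)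
shift-+ {m} i a b = toℕ-injective (begin
  toℕ (shift (shift i a) b)      ≡⟨ toℕ-shift (shift i a) b ⟩
  (toℕ (shift i a) + b) % N      ≡⟨ cong (λ t → (t + b) % N) (toℕ-shift i a) ⟩
  ((toℕ i + a) % N + b) % N      ≡⟨ %-distribˡ-+ ((toℕ i + a) % N) b N ⟩
  ((toℕ i + a) % N % N + b % N) % N  ≡⟨ cong (λ t → (t + b % N) % N) (m%n%n≡m%n (toℕ i + a) N) ⟩
  ((toℕ i + a) % N + b % N) % N  ≡⟨ %-distribˡ-+ (toℕ i + a) b N ⟨
  (toℕ i + a + b) % N            ≡⟨ cong (_% N) (+-assoc (toℕ i) a b) ⟩
  (toℕ i + (a + b)) % N          ≡⟨ toℕ-shift i (a + b) ⟨
  toℕ (shift i (a + b))          ∎)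
  where
  open ≡-Reasoning
  N = suc m

prev-shift : (i : Fin (suc m)) → prev (shift i 1) ≡ i
prev-shift {m} i = trans (shift-+ i 1 m) (shift-by-size i)

shift-prev : (i : Fin (suc m)) → shift (prev i) 1 ≡ i
shift-prev {m} i = trans (shift-+ i m 1) (trans (cong (shift i) (+-comm m 1)) (shift-by-size i))

prev-permutation : Permutation (suc m) (suc m)
prev-permutation = permutation prev (λ i → shift i 1) prev-shift shift-prev

-- Since prev = shift _ m, the s-th predecessor of i is shift i (s * m).
-- Every index is reached from i within m backward steps.
reach : (i j : Fin (suc m)) → ∃ λ s → s ≤ m × shift i (s * m) ≡ j
reach {zero}  fzero fzero = 0 , z≤n , refl
reach {suc m} i j = x % N , ≤-pred (m%n<n x N) , (begin
  shift i (x % N * suc m)                                ≡⟨ shift-period _ (x / N * suc m) ⟨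
  shift (shift i (x % N * suc m)) (x / N * suc m * N)    ≡⟨ shift-+ i _ _ ⟩
  shift i (x % N * suc m + x / N * suc m * N)            ≡⟨ cong (shift i) (regroup (x % N) (x / N) (suc m) N) ⟩
  shift i ((x % N + x / N * N) * suc m)                  ≡⟨ cong (λ t → shift i (t * suc m)) (m≡m%n+[m/n]*n x N) ⟨
  shift i (x * suc m)                                    ≡⟨ shift-≡ i j _ (toℕ i + m * toℕ j) (wraps (toℕ i) (toℕ j) m) ⟩
  j                                                      ∎)
  where
  open ≡-Reasoning
  N = suc (suc m)
  -- x ≡ toℕ i - toℕ j modulo N, because suc m ≡ -1 modulo N.
  x = toℕ i + suc m * toℕ j

  regroup : ∀ r q a b → r * a + q * a * b ≡ (r + q * b) * a
  regroup = solve-∀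

  wraps : ∀ i j m → i + (i + suc m * j) * suc m ≡ j + (i + m * j) * suc (suc m)
  wraps = solve-∀

run-≤ : (cv : Subset n) (i : Fin n) (f : ℕ) → run cv i f ≤ f
run-≤ cv i zero = z≤n
run-≤ cv i (suc f) with lookup cv (prev i)
... | false = z≤n
... | true  = s≤s (run-≤ cv (prev i) f)

run-stable : (cv : Subset n) (i : Fin n) (f : ℕ) → run cv i f < f → run cv i (suc f) ≡ run cv i f
run-stable cv i (suc f) short with lookup cv (prev i)
... | false = refl
... | true  = cong suc (run-stable cv (prev i) f (≤-pred short))

run-continue : (cv : Subset n) (i : Fin n) (f : ℕ) →
               lookup cv (prev i) ≡ true → run cv i (suc f) ≡ suc (run cv (prev i) f)
run-continue cv i f v-prev rewrite v-prev = refl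

run-start : (cv : Subset n) (i : Fin n) (f : ℕ) → lookup cv (prev i) ≡ false → run cv i (suc f) ≡ 0
run-start cv i f v-prev rewrite v-prev = refl

run-full : (cv : Subset (suc m)) (i : Fin (suc m)) (f : ℕ) → lookup cv i ≡ true → run cv i f ≡ f →
           ∀ s → s ≤ f → lookup cv (shift i (s * m)) ≡ true
run-full cv i f v-i full zero _ = subst (λ t → lookup cv t ≡ true) (sym (shift-period i 0)) v-i
run-full {m} cv i (suc f) v-i full (suc s) (s≤s s≤f) with lookup cv (prev i) in v-prev
... | true = subst (λ t → lookup cv t ≡ true) (shift-+ i m (s * m))
                   (run-full cv (prev i) f v-prev (suc-injective full) s s≤f)

-- If cv misses some vertex, a run from a member of cv stops within m steps,
-- so its length is the same whether we look back m or suc m steps.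
run-saturates : (cv : Subset (suc m)) (x : Fin (suc m)) → lookup cv x ≡ false →
                (i : Fin (suc m)) → lookup cv i ≡ true → run cv i (suc m) ≡ run cv i m
run-saturates {m} cv x v-x i v-i with m≤n⇒m<n∨m≡n (run-≤ cv i m)
... | inj₁ short = run-stable cv i m short
... | inj₂ full with reach i x
... | s , s≤m , reaches-x =
  ⊥-elim (false≢true (trans (sym v-x)
    (subst (λ t → lookup cv t ≡ true) reaches-x (run-full cv i m v-i full s s≤m))))

isOdd : ℕ → Bool
isOdd r = r % 2 ≡ᵇ 1

isOdd-+2 : ∀ r → isOdd (2 + r) ≡ isOdd r
isOdd-+2 r = cong (_≡ᵇ 1) (trans (cong (_% 2) (+-comm 2 r)) ([m+n]%n≡m%n r 2))

isOdd-suc : ∀ r → isOdd (suc r) ≡ not (isOdd r)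
isOdd-suc zero          = refl
isOdd-suc (suc zero)    = refl
isOdd-suc (suc (suc r)) = trans (isOdd-+2 (suc r)) (trans (isOdd-suc r) (cong not (sym (isOdd-+2 r))))

lookup-∉ : {p : Subset n} {i : Fin n} → i ∉ p → lookup p i ≡ false
lookup-∉ {p = p} {i} i∉p with lookup p i in e
... | false = refl
... | true  = ⊥-elim (i∉p (lookup⇒[]= i p e))

other-endpoint : {p q : Subset n} {i j : Fin n} → i ∈ p ⊎ j ∈ q → lookup p i ≡ false → lookup q j ≡ true
other-endpoint (inj₁ i∈p) i-absent = ⊥-elim (false≢true (trans (sym i-absent) ([]=⇒lookup i∈p)))
other-endpoint (inj₂ j∈q) _        = []=⇒lookup j∈q

module SemiOptimal {m : ℕ} (cu cv : Subset (suc m)) (x : Fin (suc m)) (v-x : lookup cv x ≡ false) where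

  N : ℕ
  N = suc m

  soU : Subset N
  soU = proj₁ (so (cu , cv))

  oddOffset : Fin N → Bool
  oddOffset j = isOdd (run cv j N)

  lookup-soU : ∀ j → lookup soU j ≡ not (lookup cv j) ∨ oddOffset j
  lookup-soU j = lookup∘tabulate (λ i → not (lookup cv i) ∨ oddOffset i) j

  soU-outside : ∀ j → lookup cv j ≡ false → lookup soU j ≡ true
  soU-outside j v-j = trans (lookup-soU j) (cong (λ b → not b ∨ oddOffset j) v-j)

  soU-inside : ∀ j → lookup cv j ≡ true → lookup soU j ≡ oddOffset j
  soU-inside j v-j = trans (lookup-soU j) (cong (λ b → not b ∨ oddOffset j) v-j)

  oddOffset-start : ∀ j → lookup cv (prev j) ≡ false → oddOffset j ≡ false
  oddOffset-start j v-prev = cong isOdd (run-start cv j m v-prev)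

  oddOffset-alternates : ∀ j → lookup cv (prev j) ≡ true → oddOffset j ≡ not (oddOffset (prev j))
  oddOffset-alternates j v-prev = begin
    isOdd (run cv j N)                 ≡⟨ cong isOdd (run-continue cv j m v-prev) ⟩
    isOdd (suc (run cv (prev j) m))    ≡⟨ isOdd-suc (run cv (prev j) m) ⟩
    not (isOdd (run cv (prev j) m))    ≡⟨ cong (not ∘′ isOdd) (run-saturates cv x v-x (prev j) v-prev) ⟨
    not (isOdd (run cv (prev j) N))    ∎
    where open ≡-Reasoning

  soU-covers-rim : ∀ j → lookup soU j ≡ true ⊎ lookup soU (shift j 1) ≡ true
  soU-covers-rim j with lookup cv j in v-j | lookup cv (shift j 1) in v-next
  ... | false | _     = inj₁ (soU-outside j v-j)
  ... | true  | false = inj₂ (soU-outside (shift j 1) v-next)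
  ... | true  | true with oddOffset j in odd-j
  ...   | true  = inj₁ (trans (soU-inside j v-j) odd-j)
  ...   | false = inj₂ (trans (soU-inside (shift j 1) v-next) (begin
    oddOffset (shift j 1)             ≡⟨ oddOffset-alternates (shift j 1) (subst (λ t → lookup cv t ≡ true) (sym (prev-shift j)) v-j) ⟩
    not (oddOffset (prev (shift j 1))) ≡⟨ cong (λ t → not (oddOffset t)) (prev-shift j) ⟩
    not (oddOffset j)                 ≡⟨ cong not odd-j ⟩
    true                              ∎))
    where open ≡-Reasoning

  so-is-cover : (k : ℕ) → IsVertexCover N k (cu , cv) → IsVertexCover N k (so (cu , cv))
  so-is-cover k cov i = rim , spoke , proj₂ (proj₂ (cov i))
    where
    rim : i ∈ soU ⊎ shift i 1 ∈ soU
    rim with soU-covers-rim i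
    ... | inj₁ u-i    = inj₁ (lookup⇒[]= i soU u-i)
    ... | inj₂ u-next = inj₂ (lookup⇒[]= (shift i 1) soU u-next)

    spoke : i ∈ soU ⊎ i ∈ cv
    spoke with lookup cv i in v-i
    ... | false = inj₁ (lookup⇒[]= i soU (soU-outside i v-i))
    ... | true  = inj₂ (lookup⇒[]= i cv v-i)

  charge : (k : ℕ) → IsVertexCover N k (cu , cv) →
           ∀ j → lookup soU j ≡ true → lookup cu j ≡ false →
           lookup cu (prev j) ≡ true × lookup soU (prev j) ≡ false
  charge k cov j u-j u-j∉cu = u-prev , u-prev∉soU
    where
    v-j : lookup cv j ≡ true
    v-j = other-endpoint (proj₁ (proj₂ (cov j))) u-j∉cu

    odd-j : oddOffset j ≡ true
    odd-j = trans (sym (soU-inside j v-j)) u-j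

    v-prev : lookup cv (prev j) ≡ true
    v-prev with lookup cv (prev j) in v-prev
    ... | true  = refl
    ... | false = ⊥-elim (false≢true (trans (sym (oddOffset-start j v-prev)) odd-j))

    u-prev∉soU : lookup soU (prev j) ≡ false
    u-prev∉soU with oddOffset (prev j) in odd-prev
    ... | false = trans (soU-inside (prev j) v-prev) odd-prev
    ... | true  = ⊥-elim (false≢true (trans (sym (cong not odd-prev))
                    (trans (sym (oddOffset-alternates j v-prev)) odd-j)))

    u-prev : lookup cu (prev j) ≡ true
    u-prev = other-endpoint (swap (subst (λ t → prev j ∈ cu ⊎ t ∈ cu) (shift-prev j) (proj₁ (cov (prev j)))))
                            u-j∉cu

  so-smaller : (k : ℕ) → IsVertexCover N k (cu , cv) → ∣ soU ∣ ≤ ∣ cu ∣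
  so-smaller k cov = card-≤-by-charging prev-permutation soU cu (charge k cov)

lemma1 : (n k : ℕ) → 1 ≤ k → 2 * k < n → (c : VSet n) →
    IsVertexCover n k c → ∃ (λ (j : Fin n) → j ∉ proj₂ c) →
    IsVertexCover n k (so c) × size (so c) ≤ size c
lemma1 zero    k _ () _ _ _
lemma1 (suc m) k _ _ (cu , cv) cov (x , x∉cv) =
  so-is-cover k cov , +-monoˡ-≤ ∣ cv ∣ (so-smaller k cov)
  where open SemiOptimal cu cv x (lookup-∉ x∉cv)
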